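{- Let $(\mathbb{K},\succ)$ be a real-closed ordered field and let $(V,b)$ be a finite graph over $\mathbb{K}$ without isolated vertices, with $N=\#V$ vertices and at least one edge. (a) If $N=2K\ge 2$ is even, then $\overline h\succeq \frac{N}{2(N-1)}$. (b) If $N=2K+1>2$ is odd, then $\overline h\succeq \frac{N+1}{2N}$.
   Context: A graph over $\mathbb{K}$ is a pair $(V,b)$ with $V$ a set and $b:V\times V\to \mathbb{K}^+\cup\{0\}$ (nonnegative elements of $\mathbb{K}$) satisfying $b(x,y)=b(y,x)$ and $b(x,x)=0$; we write $x\sim y$ iff $b(x,y)\neq 0$ (an edge). Set $b(x)=\sum_{y\in V}b(x,y)$; $x$ is isolated if $b(x)=0$. For $V_1\subset V$, $b(V_1)=\sum_{x\in V_1}b(x)$, and for disjoint $V_1,V_2\subset V$, $b(V_1,V_2)=\sum_{x\in V_1,y\in V_2}b(x,y)$. The dual Cheeger constant is $\overline h=\max \frac{2b(V_1,V_2)}{b(V_1)+b(V_2)}$, the maximum over all pairs of nonempty disjoint subsets $V_1,V_2\subset V$. The symbols $\succ,\succeq,\preceq$ denote the order of $\mathbb{K}$. -}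

module Defs where

open import Level using (Level; _⊔_)
open import Algebra.Bundles using (CommutativeRing)
open import Relation.Binary.Core using (Rel)
open import Relation.Binary.Structures using (IsTotalOrder)
open import Relation.Nullary using (¬_)
open import Data.Nat as ℕ using (ℕ)
open import Data.Fin as Fin using (Fin)
open import Data.Fin.Subset using (Subset; _∈_; _∉_; Nonempty)
open import Data.Vec using (lookup)
open import Data.Bool using (if_then_else_)
open import Data.List using (List; []; _∷_; _++_; [_]; length)
open import Data.Product using (Σ; ∃; _×_; _,_)
open import Relation.Binary.PropositionalEquality using (_≡_)

record OrderedField (c ℓ₁ ℓ₂ : Level) : Set (Level.suc (c ⊔ ℓ₁ ⊔ ℓ₂)) where
  field
    commutativeRing : CommutativeRing c ℓ₁
  open CommutativeRing commutativeRing public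
  field
    _⁻¹        : Carrier → Carrier
    ⁻¹-inverse : ∀ x → ¬ (x ≈ 0#) → x * (x ⁻¹) ≈ 1#
    0≉1        : ¬ (0# ≈ 1#)
    _≤_        : Rel Carrier ℓ₂
    isTotalOrder : IsTotalOrder _≈_ _≤_
    +-mono-≤   : ∀ {x y} z → x ≤ y → (x + z) ≤ (y + z)
    *-nonneg   : ∀ {x y} → 0# ≤ x → 0# ≤ y → 0# ≤ (x * y)

  evalPoly : List Carrier → Carrier → Carrier
  evalPoly []       x = 0#
  evalPoly (a ∷ as) x = a + x * evalPoly as x

  fromℕ : ℕ → Carrier
  fromℕ ℕ.zero    = 0#
  fromℕ (ℕ.suc n) = 1# + fromℕ n

-- Real-closed ordered field: every nonnegative element is a square and
-- every polynomial of odd degree has a root (monic WLOG).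
record RealClosedField (c ℓ₁ ℓ₂ : Level) : Set (Level.suc (c ⊔ ℓ₁ ⊔ ℓ₂)) where
  field
    orderedField : OrderedField c ℓ₁ ℓ₂
  open OrderedField orderedField public
  field
    sqrt-exists : ∀ x → 0# ≤ x → ∃ λ y → (y * y) ≈ x
    -- the monic polynomial a₀ + a₁X + … + a_{n-1}X^{n-1} + Xⁿ with n odd has a root
    oddDegree-root : ∀ (k : ℕ) (as : List Carrier) → length as ≡ ℕ.suc (k ℕ.+ k) →
                     ∃ λ x → evalPoly (as ++ [ 1# ]) x ≈ 0#

module GraphDefs {c ℓ₁ ℓ₂} (F : RealClosedField c ℓ₁ ℓ₂) where
  open RealClosedField F

  sumF : ∀ {n} → (Fin n → Carrier) → Carrier
  sumF {ℕ.zero}  f = 0#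
  sumF {ℕ.suc n} f = f Fin.zero + sumF (λ i → f (Fin.suc i))

  module _ {N : ℕ} (b : Fin N → Fin N → Carrier) where
    IsGraph : Set (ℓ₁ ⊔ ℓ₂)
    IsGraph = (∀ x y → b x y ≈ b y x) × (∀ x → b x x ≈ 0#) × (∀ x y → 0# ≤ b x y)

    deg : Fin N → Carrier
    deg x = sumF (λ y → b x y)

    NoIsolated : Set ℓ₁
    NoIsolated = ∀ x → ¬ (deg x ≈ 0#)

    HasEdge : Set ℓ₁
    HasEdge = Σ (Fin N) λ x → Σ (Fin N) λ y → ¬ (b x y ≈ 0#)

    volume : Subset N → Carrier
    volume V₁ = sumF (λ x → if lookup V₁ x then deg x else 0#)

    edgeWeight : Subset N → Subset N → Carrier
    edgeWeight V₁ V₂ = sumF (λ x → if lookup V₁ x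
                                    then sumF (λ y → if lookup V₂ y then b x y else 0#)
                                    else 0#)

    Disjoint : Subset N → Subset N → Set
    Disjoint V₁ V₂ = ∀ x → x ∈ V₁ → x ∉ V₂

    Admissible : Subset N → Subset N → Set
    Admissible V₁ V₂ = Nonempty V₁ × Nonempty V₂ × Disjoint V₁ V₂

    ratio : Subset N → Subset N → Carrier
    ratio V₁ V₂ = ((1# + 1#) * edgeWeight V₁ V₂) * ((volume V₁ + volume V₂) ⁻¹)

    IsDualCheeger : Carrier → Set (ℓ₁ ⊔ ℓ₂)
    IsDualCheeger h =
      (Σ (Subset N) λ V₁ → Σ (Subset N) λ V₂ → Admissible V₁ V₂ × ratio V₁ V₂ ≈ h) ×
      (∀ V₁ V₂ → Admissible V₁ V₂ → ratio V₁ V₂ ≤ h)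

-- Average the defining inequality of the dual Cheeger constant over all pairs (S, V ∖ S) with
-- |S| = m.  Each pair is admissible with b(S) + b(V ∖ S) = b(V), so 2 b(S, V ∖ S) ≤ h b(V).
-- Each ordered pair of distinct vertices x, y is separated (x ∈ S, y ∉ S) by exactly C(N-2, m-1)
-- of the C(N, m) sets S, so the cuts add up to C(N-2, m-1) b(V), and since b(V) > 0,
-- h ≥ 2 C(N-2, m-1) / C(N, m) = 2 m (N-m) / (N (N-1)).  Taking m = ⌊N/2⌋ gives both bounds.

module Submission where

open import Defs
open import Algebra.Bundles using (Semiring)
open import Data.Bool using (Bool; true; false; not; _∧_; if_then_else_)
open import Data.Bool.Properties using (∧-zeroʳ; ∧-identityʳ)
open import Data.Empty using (⊥-elim)
open import Data.Fin using (Fin; zero; suc; _≟_)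
open import Data.Fin.Subset using (Subset; ⊥; ∁; inside; outside; Nonempty)
open import Data.List using (List; []; _∷_; _++_; [_]; map; length)
open import Data.List.Properties using (length-++; length-map)
open import Data.List.Relation.Unary.All as All using (All)
open import Data.List.Relation.Unary.All.Properties using (++⁺; map⁺)
open import Data.Nat as ℕ using (ℕ; zero; suc; NonZero; s≤s)
open import Data.Nat.Combinatorics using (_C_; nCk+nC[k+1]≡[n+1]C[k+1])
open import Data.Product using (_,_; proj₁; proj₂)
open import Data.Sum using (inj₁; inj₂)
open import Data.Vec using (_∷_; lookup; here; there)
open import Data.Vec.Properties using (lookup-replicate)
open import Function using (_∘_)
open import Relation.Nullary using (¬_; yes; no)
import Relation.Binary.PropositionalEquality as ≡
open ≡ using (_≡_; _≢_)

module Binomial where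
  open import Data.Nat using (_+_; _*_)
  open import Data.Nat.Properties
    using (<-≤-trans; *-assoc; *-commutativeSemigroup; m≤m+n; m+n∸m≡n; +-suc; *-zeroʳ; *-comm; *-cancelˡ-≡)
  open import Data.Nat.Combinatorics using (nCk≡nC[n∸k]; nC1≡n)
  open import Data.Nat.Tactic.RingSolver using (solve-∀)
  open import Algebra.Properties.CommutativeSemigroup *-commutativeSemigroup using (x∙yz≈y∙xz; xy∙z≈y∙xz)
  open ≡ using (refl; sym; trans; cong; cong₂; subst; module ≡-Reasoning)

  C-sym : ∀ a b → (a + b) C a ≡ (a + b) C b
  C-sym a b = trans (nCk≡nC[n∸k] (m≤m+n a b)) (cong ((a + b) C_) (m+n∸m≡n a b))

  C-absorption : ∀ n k → suc k * (suc n C suc k) ≡ suc n * (n C k)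
  C-absorption zero    zero    = refl
  C-absorption zero    (suc k) = *-zeroʳ (suc (suc k))
  C-absorption (suc n) zero    = trans (cong (1 *_) (nC1≡n (suc (suc n)))) (*-comm 1 (suc (suc n)))
  C-absorption (suc n) (suc k) = begin
    suc (suc k) * (suc (suc n) C suc (suc k))
      ≡⟨ cong (suc (suc k) *_) (sym (nCk+nC[k+1]≡[n+1]C[k+1] (suc n) (suc k))) ⟩
    suc (suc k) * (suc n C suc k + suc n C suc (suc k))
      ≡⟨ regroup k (suc n C suc k) (suc n C suc (suc k)) ⟩
    suc k * (suc n C suc k) + suc n C suc k + suc (suc k) * (suc n C suc (suc k))
      ≡⟨ cong₂ (λ u v → u + suc n C suc k + v) (C-absorption n k) (C-absorption n (suc k)) ⟩
    suc n * (n C k) + suc n C suc k + suc n * (n C suc k)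
      ≡⟨ collect n (n C k) (suc n C suc k) (n C suc k) ⟩
    suc n * (n C k + n C suc k) + suc n C suc k
      ≡⟨ cong (λ u → suc n * u + suc n C suc k) (nCk+nC[k+1]≡[n+1]C[k+1] n k) ⟩
    suc n * (suc n C suc k) + suc n C suc k
      ≡⟨ *-suc-distrib n (suc n C suc k) ⟩
    suc (suc n) * (suc n C suc k) ∎
    where
    open ≡-Reasoning
    regroup : ∀ k p q → suc (suc k) * (p + q) ≡ suc k * p + p + suc (suc k) * q
    regroup = solve-∀
    collect : ∀ n a p b → suc n * a + p + suc n * b ≡ suc n * (a + b) + p
    collect = solve-∀
    *-suc-distrib : ∀ n p → suc n * p + p ≡ suc (suc n) * p
    *-suc-distrib = solve-∀

  C-double-absorption : ∀ {n} a b → a + b ≡ n →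
    suc a * suc b * ((2 + n) C suc a) ≡ (2 + n) * suc n * (n C a)
  C-double-absorption a b refl = begin
    suc a * suc b * ((2 + (a + b)) C suc a)  ≡⟨ xy∙z≈y∙xz (suc a) (suc b) ((2 + (a + b)) C suc a) ⟩
    suc b * (suc a * ((2 + (a + b)) C suc a)) ≡⟨ cong (suc b *_) (C-absorption (suc (a + b)) a) ⟩
    suc b * ((2 + (a + b)) * (suc (a + b) C a)) ≡⟨ x∙yz≈y∙xz (suc b) (2 + (a + b)) (suc (a + b) C a) ⟩
    (2 + (a + b)) * (suc b * (suc (a + b) C a)) ≡⟨ cong (λ m → (2 + (a + b)) * (suc b * m)) sym-suc ⟩
    (2 + (a + b)) * (suc b * (suc (a + b) C suc b)) ≡⟨ cong ((2 + (a + b)) *_) (C-absorption (a + b) b) ⟩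
    (2 + (a + b)) * (suc (a + b) * ((a + b) C b)) ≡⟨ cong (λ m → (2 + (a + b)) * (suc (a + b) * m)) (sym (C-sym a b)) ⟩
    (2 + (a + b)) * (suc (a + b) * ((a + b) C a)) ≡⟨ sym (*-assoc (2 + (a + b)) (suc (a + b)) ((a + b) C a)) ⟩
    (2 + (a + b)) * suc (a + b) * ((a + b) C a) ∎
    where
    open ≡-Reasoning
    sym-suc : suc (a + b) C a ≡ suc (a + b) C suc b
    sym-suc = subst (λ m → m C a ≡ m C suc b) (+-suc a b) (C-sym a (suc b))

  nCk>0 : ∀ {n k} → k ℕ.≤ n → 0 ℕ.< n C k
  nCk>0 {k = zero}          _         = ℕ.z<s
  nCk>0 {suc n} {suc k} (s≤s k≤n) =
    subst (0 ℕ.<_) (nCk+nC[k+1]≡[n+1]C[k+1] n k) (<-≤-trans (nCk>0 k≤n) (m≤m+n (n C k) (n C suc k)))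

  C-even-identity : ∀ {n} k → n ≡ k + k → (2 + n) * ((2 + n) C suc k) ≡ 2 * suc n * (2 * (n C k))
  C-even-identity k refl = *-cancelˡ-≡ _ _ (suc k) (begin
    suc k * ((2 + (k + k)) * X)            ≡⟨ expand k X ⟩
    2 * (suc k * suc k * X)                ≡⟨ cong (2 *_) (C-double-absorption k k refl) ⟩
    2 * ((2 + (k + k)) * suc (k + k) * Y)  ≡⟨ collect k Y ⟩
    suc k * (2 * suc (k + k) * (2 * Y))    ∎)
    where
    open ≡-Reasoning
    X Y : ℕ
    X = (2 + (k + k)) C suc k
    Y = (k + k) C k
    expand : ∀ k X → suc k * ((2 + (k + k)) * X) ≡ 2 * (suc k * suc k * X)
    expand = solve-∀
    collect : ∀ k Y → 2 * ((2 + (k + k)) * suc (k + k) * Y) ≡ suc k * (2 * suc (k + k) * (2 * Y))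
    collect = solve-∀

  C-odd-identity : ∀ {n} k → n ≡ suc (k + k) → (2 + n + 1) * ((2 + n) C suc k) ≡ 2 * (2 + n) * (2 * (n C k))
  C-odd-identity k refl = *-cancelˡ-≡ _ _ (suc k) (begin
    suc k * ((3 + (k + k) + 1) * X)          ≡⟨ expand k X ⟩
    2 * (suc k * suc (suc k) * X)            ≡⟨ cong (2 *_) (C-double-absorption k (suc k) (+-suc k k)) ⟩
    2 * ((3 + (k + k)) * (2 + (k + k)) * Y)  ≡⟨ collect k Y ⟩
    suc k * (2 * (3 + (k + k)) * (2 * Y))    ∎)
    where
    open ≡-Reasoning
    X Y : ℕ
    X = (3 + (k + k)) C suc k
    Y = suc (k + k) C k
    expand : ∀ k X → suc k * ((3 + (k + k) + 1) * X) ≡ 2 * (suc k * suc (suc k) * X)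
    expand = solve-∀
    collect : ∀ k Y → 2 * ((3 + (k + k)) * (2 + (k + k)) * Y) ≡ suc k * (2 * (3 + (k + k)) * (2 * Y))
    collect = solve-∀

open Binomial

module Parity where
  open import Data.Nat using (_+_; _*_)
  open import Data.Nat.Properties using (suc-injective)
  open import Data.Nat.Tactic.RingSolver using (solve-∀)

  even-half : ∀ {n k} → suc (suc n) ≡ 2 * suc k → n ≡ k + k
  even-half {n} {k} eq = suc-injective (suc-injective (≡.trans eq (2*[1+k] k)))
    where
    2*[1+k] : ∀ k → 2 * suc k ≡ suc (suc (k + k))
    2*[1+k] = solve-∀

  odd-half : ∀ {n k} → suc (suc n) ≡ 2 * suc k + 1 → n ≡ suc (k + k)
  odd-half {n} {k} eq = suc-injective (suc-injective (≡.trans eq (2*[1+k]+1 k)))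
    where
    2*[1+k]+1 : ∀ k → 2 * suc k + 1 ≡ suc (suc (suc (k + k)))
    2*[1+k]+1 = solve-∀

open Parity

subsetsOfSize : (n k : ℕ) → List (Subset n)
subsetsOfSize n       zero    = [ ⊥ ]
subsetsOfSize zero    (suc k) = []
subsetsOfSize (suc n) (suc k) =
  map (inside ∷_) (subsetsOfSize n k) ++ map (outside ∷_) (subsetsOfSize n (suc k))

length-subsetsOfSize : (n k : ℕ) → length (subsetsOfSize n k) ≡ n C k
length-subsetsOfSize n       zero    = ≡.refl
length-subsetsOfSize zero    (suc k) = ≡.refl
length-subsetsOfSize (suc n) (suc k) = begin
  length (map (inside ∷_) (subsetsOfSize n k) ++ map (outside ∷_) (subsetsOfSize n (suc k)))
    ≡⟨ length-++ (map (inside ∷_) (subsetsOfSize n k)) ⟩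
  length (map (inside ∷_) (subsetsOfSize n k)) ℕ.+ length (map (outside ∷_) (subsetsOfSize n (suc k)))
    ≡⟨ ≡.cong₂ ℕ._+_ (length-map _ (subsetsOfSize n k)) (length-map _ (subsetsOfSize n (suc k))) ⟩
  length (subsetsOfSize n k) ℕ.+ length (subsetsOfSize n (suc k))
    ≡⟨ ≡.cong₂ ℕ._+_ (length-subsetsOfSize n k) (length-subsetsOfSize n (suc k)) ⟩
  n C k ℕ.+ n C suc k
    ≡⟨ nCk+nC[k+1]≡[n+1]C[k+1] n k ⟩
  suc n C suc k ∎
  where open ≡.≡-Reasoning

Nonempty-∷ : ∀ {n} {S : Subset n} b → Nonempty S → Nonempty (b ∷ S)
Nonempty-∷ b (x , x∈S) = suc x , there x∈S

Nonempty-inside∷ : ∀ {n} (S : Subset n) → Nonempty (inside ∷ S)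
Nonempty-inside∷ S = zero , here

subsetsOfSize-nonempty : (n k : ℕ) → All Nonempty (subsetsOfSize n (suc k))
subsetsOfSize-nonempty zero    k = All.[]
subsetsOfSize-nonempty (suc n) k = ++⁺
  (map⁺ (All.universal Nonempty-inside∷ (subsetsOfSize n k)))
  (map⁺ (All.map (Nonempty-∷ outside) (subsetsOfSize-nonempty n k)))

subsetsOfSize-∁-nonempty : ∀ {n k : ℕ} → k ℕ.≤ n → All (λ S → Nonempty (∁ S)) (subsetsOfSize (suc n) k)
subsetsOfSize-∁-nonempty {k = zero}          _         = (zero , here) All.∷ All.[]
subsetsOfSize-∁-nonempty {suc n} {suc k} (s≤s k≤n) = ++⁺
  (map⁺ (All.map (Nonempty-∷ outside) (subsetsOfSize-∁-nonempty k≤n)))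
  (map⁺ (All.universal (Nonempty-inside∷ ∘ ∁) (subsetsOfSize (suc n) (suc k))))

separates : ∀ {n} → Subset n → Fin n → Fin n → Bool
separates S x y = lookup S x ∧ not (lookup S y)

lookup-⊥ : ∀ {n} (x : Fin n) → lookup ⊥ x ≡ outside
lookup-⊥ x = lookup-replicate x outside

module SubsetCounting {c ℓ} (R : Semiring c ℓ) where
  open Semiring R hiding (zero)
  open import Algebra.Properties.Semiring.Sum R
    using (sum; sum-syntax; sum-cong-≋; ∑-distrib-+; sum-replicate-zero; *-distribˡ-sum)
  open import Algebra.Properties.Semiring.Mult R using (_×_; ×-homo-+)
  open import Relation.Binary.Reasoning.Setoid setoid

  ∑L : ∀ {a} {A : Set a} → List A → (A → Carrier) → Carrier
  ∑L []      f = 0#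
  ∑L (S ∷ L) f = f S + ∑L L f

  𝟙 : Bool → Carrier
  𝟙 true  = 1#
  𝟙 false = 0#

  ∑L-cong : ∀ {a} {A : Set a} (L : List A) {f g : A → Carrier} → (∀ S → f S ≈ g S) → ∑L L f ≈ ∑L L g
  ∑L-cong []      f≈g = refl
  ∑L-cong (S ∷ L) f≈g = +-cong (f≈g S) (∑L-cong L f≈g)

  ∑L-zero : ∀ {a} {A : Set a} (L : List A) → ∑L L (λ _ → 0#) ≈ 0#
  ∑L-zero []      = refl
  ∑L-zero (S ∷ L) = trans (+-identityˡ _) (∑L-zero L)

  ∑L-one : ∀ {a} {A : Set a} (L : List A) → ∑L L (λ _ → 1#) ≈ length L × 1#
  ∑L-one []      = refl
  ∑L-one (S ∷ L) = +-congˡ (∑L-one L)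

  ∑L-++ : ∀ {a} {A : Set a} (L M : List A) (f : A → Carrier) → ∑L (L ++ M) f ≈ ∑L L f + ∑L M f
  ∑L-++ []      M f = sym (+-identityˡ _)
  ∑L-++ (S ∷ L) M f = trans (+-congˡ (∑L-++ L M f)) (sym (+-assoc _ _ _))

  ∑L-map : ∀ {a b} {A : Set a} {B : Set b} (g : A → B) (L : List A) (f : B → Carrier) →
           ∑L (map g L) f ≡ ∑L L (f ∘ g)
  ∑L-map g []      f = ≡.refl
  ∑L-map g (S ∷ L) f = ≡.cong (f (g S) +_) (∑L-map g L f)

  ∑L-*ʳ : ∀ {a} {A : Set a} (L : List A) (f : A → Carrier) (x : Carrier) → ∑L L (λ S → f S * x) ≈ ∑L L f * x
  ∑L-*ʳ []      f x = sym (zeroˡ x)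
  ∑L-*ʳ (S ∷ L) f x = trans (+-congˡ (∑L-*ʳ L f x)) (sym (distribʳ x _ _))

  ∑L-*ˡ : ∀ {a} {A : Set a} (L : List A) (x : Carrier) (f : A → Carrier) → ∑L L (λ S → x * f S) ≈ x * ∑L L f
  ∑L-*ˡ []      x f = sym (zeroʳ x)
  ∑L-*ˡ (S ∷ L) x f = trans (+-congˡ (∑L-*ˡ L x f)) (sym (distribˡ x _ _))

  ∑L-const : ∀ {a} {A : Set a} (L : List A) (x : Carrier) → ∑L L (λ _ → x) ≈ (length L × 1#) * x
  ∑L-const L x = begin
    ∑L L (λ _ → x)        ≈⟨ ∑L-cong L (λ _ → sym (*-identityˡ x)) ⟩
    ∑L L (λ _ → 1# * x)   ≈⟨ ∑L-*ʳ L (λ _ → 1#) x ⟩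
    ∑L L (λ _ → 1#) * x   ≈⟨ *-congʳ (∑L-one L) ⟩
    (length L × 1#) * x   ∎

  ∑L-comm-∑ : ∀ {a} {A : Set a} {n} (L : List A) (f : A → Fin n → Carrier) →
              ∑L L (λ S → ∑[ i < n ] f S i) ≈ ∑[ i < n ] ∑L L (λ S → f S i)
  ∑L-comm-∑ {n = n} []      f = sym (sum-replicate-zero n)
  ∑L-comm-∑         (S ∷ L) f = trans (+-congˡ (∑L-comm-∑ L f)) (sym (∑-distrib-+ (f S) _))

  if-then-0≈𝟙* : ∀ a x → (if a then x else 0#) ≈ 𝟙 a * x
  if-then-0≈𝟙* true  x = sym (*-identityˡ x)
  if-then-0≈𝟙* false x = sym (zeroˡ x)

  𝟙-∧ : ∀ a b → 𝟙 (a ∧ b) ≈ 𝟙 a * 𝟙 b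
  𝟙-∧ true  b = sym (*-identityˡ (𝟙 b))
  𝟙-∧ false b = sym (zeroˡ (𝟙 b))

  ∑L-subsetsOfSize-suc : ∀ n k (f : Subset (suc n) → Carrier) →
    ∑L (subsetsOfSize (suc n) (suc k)) f ≈
    ∑L (subsetsOfSize n k) (f ∘ (inside ∷_)) + ∑L (subsetsOfSize n (suc k)) (f ∘ (outside ∷_))
  ∑L-subsetsOfSize-suc n k f = trans (∑L-++ (map (inside ∷_) (subsetsOfSize n k)) _ f)
    (+-cong (reflexive (∑L-map _ (subsetsOfSize n k) f)) (reflexive (∑L-map _ (subsetsOfSize n (suc k)) f)))

  count-subsetsOfSize : ∀ n k → ∑L (subsetsOfSize n k) (λ _ → 1#) ≈ (n C k) × 1#
  count-subsetsOfSize n k = trans (∑L-one (subsetsOfSize n k)) (reflexive (≡.cong (_× 1#) (length-subsetsOfSize n k)))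

  pascal-× : ∀ n k → (n C k) × 1# + (n C suc k) × 1# ≈ (suc n C suc k) × 1#
  pascal-× n k = trans (sym (×-homo-+ 1# (n C k) (n C suc k))) (reflexive (≡.cong (_× 1#) (nCk+nC[k+1]≡[n+1]C[k+1] n k)))

  count-∈ : ∀ n k (x : Fin (suc n)) →
            ∑L (subsetsOfSize (suc n) (suc k)) (λ S → 𝟙 (lookup S x)) ≈ (n C k) × 1#
  count-∈ n k zero = begin
    ∑L (subsetsOfSize (suc n) (suc k)) (λ S → 𝟙 (lookup S zero))
      ≈⟨ ∑L-subsetsOfSize-suc n k _ ⟩
    ∑L (subsetsOfSize n k) (λ _ → 1#) + ∑L (subsetsOfSize n (suc k)) (λ _ → 0#)
      ≈⟨ +-cong (count-subsetsOfSize n k) (∑L-zero (subsetsOfSize n (suc k))) ⟩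
    (n C k) × 1# + 0#
      ≈⟨ +-identityʳ _ ⟩
    (n C k) × 1# ∎
  count-∈ (suc n) zero (suc x) = begin
    ∑L (subsetsOfSize (2 ℕ.+ n) 1) (λ S → 𝟙 (lookup S (suc x)))
      ≈⟨ ∑L-subsetsOfSize-suc (suc n) zero _ ⟩
    (𝟙 (lookup ⊥ x) + 0#) + ∑L (subsetsOfSize (suc n) 1) (λ S → 𝟙 (lookup S x))
      ≈⟨ +-cong (trans (+-identityʳ _) (reflexive (≡.cong 𝟙 (lookup-⊥ x)))) (count-∈ n zero x) ⟩
    0# + 1 × 1#
      ≈⟨ +-identityˡ _ ⟩
    1 × 1# ∎
  count-∈ (suc n) (suc k) (suc x) = begin
    ∑L (subsetsOfSize (2 ℕ.+ n) (2 ℕ.+ k)) (λ S → 𝟙 (lookup S (suc x)))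
      ≈⟨ ∑L-subsetsOfSize-suc (suc n) (suc k) _ ⟩
    ∑L (subsetsOfSize (suc n) (suc k)) (λ S → 𝟙 (lookup S x)) +
    ∑L (subsetsOfSize (suc n) (2 ℕ.+ k)) (λ S → 𝟙 (lookup S x))
      ≈⟨ +-cong (count-∈ n k x) (count-∈ n (suc k) x) ⟩
    (n C k) × 1# + (n C suc k) × 1#
      ≈⟨ pascal-× n k ⟩
    (suc n C suc k) × 1# ∎

  count-∉ : ∀ n k (y : Fin (suc n)) →
            ∑L (subsetsOfSize (suc n) k) (λ S → 𝟙 (not (lookup S y))) ≈ (n C k) × 1#
  count-∉ n zero y = +-congʳ (reflexive (≡.cong (𝟙 ∘ not) (lookup-⊥ y)))
  count-∉ n (suc k) zero = begin
    ∑L (subsetsOfSize (suc n) (suc k)) (λ S → 𝟙 (not (lookup S zero)))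
      ≈⟨ ∑L-subsetsOfSize-suc n k _ ⟩
    ∑L (subsetsOfSize n k) (λ _ → 0#) + ∑L (subsetsOfSize n (suc k)) (λ _ → 1#)
      ≈⟨ +-cong (∑L-zero (subsetsOfSize n k)) (count-subsetsOfSize n (suc k)) ⟩
    0# + (n C suc k) × 1#
      ≈⟨ +-identityˡ _ ⟩
    (n C suc k) × 1# ∎
  count-∉ (suc n) (suc k) (suc y) = begin
    ∑L (subsetsOfSize (2 ℕ.+ n) (suc k)) (λ S → 𝟙 (not (lookup S (suc y))))
      ≈⟨ ∑L-subsetsOfSize-suc (suc n) k _ ⟩
    ∑L (subsetsOfSize (suc n) k) (λ S → 𝟙 (not (lookup S y))) +
    ∑L (subsetsOfSize (suc n) (suc k)) (λ S → 𝟙 (not (lookup S y)))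
      ≈⟨ +-cong (count-∉ n k y) (count-∉ n (suc k) y) ⟩
    (n C k) × 1# + (n C suc k) × 1#
      ≈⟨ pascal-× n k ⟩
    (suc n C suc k) × 1# ∎

  count-separates : ∀ n k (x y : Fin (2 ℕ.+ n)) → x ≢ y →
    ∑L (subsetsOfSize (2 ℕ.+ n) (suc k)) (λ S → 𝟙 (separates S x y)) ≈ (n C k) × 1#
  count-separates n k zero zero x≢y = ⊥-elim (x≢y ≡.refl)
  count-separates n k zero (suc y) _ = begin
    ∑L (subsetsOfSize (2 ℕ.+ n) (suc k)) (λ S → 𝟙 (separates S zero (suc y)))
      ≈⟨ ∑L-subsetsOfSize-suc (suc n) k _ ⟩
    ∑L (subsetsOfSize (suc n) k) (λ T → 𝟙 (not (lookup T y))) + ∑L (subsetsOfSize (suc n) (suc k)) (λ _ → 0#)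
      ≈⟨ +-cong (count-∉ n k y) (∑L-zero (subsetsOfSize (suc n) (suc k))) ⟩
    (n C k) × 1# + 0#
      ≈⟨ +-identityʳ _ ⟩
    (n C k) × 1# ∎
  count-separates n k (suc x) zero _ = begin
    ∑L (subsetsOfSize (2 ℕ.+ n) (suc k)) (λ S → 𝟙 (separates S (suc x) zero))
      ≈⟨ ∑L-subsetsOfSize-suc (suc n) k _ ⟩
    ∑L (subsetsOfSize (suc n) k) (λ T → 𝟙 (lookup T x ∧ false)) +
    ∑L (subsetsOfSize (suc n) (suc k)) (λ T → 𝟙 (lookup T x ∧ true))
      ≈⟨ +-cong (∑L-cong (subsetsOfSize (suc n) k) (λ T → reflexive (≡.cong 𝟙 (∧-zeroʳ (lookup T x)))))
                (∑L-cong (subsetsOfSize (suc n) (suc k)) (λ T → reflexive (≡.cong 𝟙 (∧-identityʳ (lookup T x))))) ⟩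
    ∑L (subsetsOfSize (suc n) k) (λ _ → 0#) + ∑L (subsetsOfSize (suc n) (suc k)) (λ T → 𝟙 (lookup T x))
      ≈⟨ +-cong (∑L-zero (subsetsOfSize (suc n) k)) (count-∈ n k x) ⟩
    0# + (n C k) × 1#
      ≈⟨ +-identityˡ _ ⟩
    (n C k) × 1# ∎
  count-separates zero k (suc zero) (suc zero) x≢y = ⊥-elim (x≢y ≡.refl)
  count-separates (suc n) zero (suc x) (suc y) x≢y = begin
    ∑L (subsetsOfSize (3 ℕ.+ n) 1) (λ S → 𝟙 (separates S (suc x) (suc y)))
      ≈⟨ ∑L-subsetsOfSize-suc (2 ℕ.+ n) zero _ ⟩
    (𝟙 (separates ⊥ x y) + 0#) + ∑L (subsetsOfSize (2 ℕ.+ n) 1) (λ T → 𝟙 (separates T x y))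
      ≈⟨ +-cong (trans (+-identityʳ _) (reflexive (≡.cong (λ a → 𝟙 (a ∧ not (lookup ⊥ y))) (lookup-⊥ x))))
                (count-separates n zero x y (x≢y ∘ ≡.cong suc)) ⟩
    0# + 1 × 1#
      ≈⟨ +-identityˡ _ ⟩
    1 × 1# ∎
  count-separates (suc n) (suc k) (suc x) (suc y) x≢y = begin
    ∑L (subsetsOfSize (3 ℕ.+ n) (2 ℕ.+ k)) (λ S → 𝟙 (separates S (suc x) (suc y)))
      ≈⟨ ∑L-subsetsOfSize-suc (2 ℕ.+ n) (suc k) _ ⟩
    ∑L (subsetsOfSize (2 ℕ.+ n) (suc k)) (λ T → 𝟙 (separates T x y)) +
    ∑L (subsetsOfSize (2 ℕ.+ n) (2 ℕ.+ k)) (λ T → 𝟙 (separates T x y))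
      ≈⟨ +-cong (count-separates n k x y (x≢y ∘ ≡.cong suc)) (count-separates n (suc k) x y (x≢y ∘ ≡.cong suc)) ⟩
    (n C k) × 1# + (n C suc k) × 1#
      ≈⟨ pascal-× n k ⟩
    (suc n C suc k) × 1# ∎

  ∑L-cut : ∀ {n} (L : List (Subset n)) (s : Carrier) (w : Fin n → Fin n → Carrier) →
           (∀ x → w x x ≈ 0#) →
           (∀ x y → x ≢ y → ∑L L (λ S → 𝟙 (separates S x y)) ≈ s) →
           ∑L L (λ S → ∑[ x < n ] ∑[ y < n ] (𝟙 (separates S x y) * w x y)) ≈ s * ∑[ x < n ] ∑[ y < n ] w x y
  ∑L-cut {n} L s w w-diag count = begin
    ∑L L (λ S → ∑[ x < n ] ∑[ y < n ] (𝟙 (separates S x y) * w x y))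
      ≈⟨ ∑L-comm-∑ L (λ S x → ∑[ y < n ] (𝟙 (separates S x y) * w x y)) ⟩
    ∑[ x < n ] ∑L L (λ S → ∑[ y < n ] (𝟙 (separates S x y) * w x y))
      ≈⟨ sum-cong-≋ (λ x → ∑L-comm-∑ L (λ S y → 𝟙 (separates S x y) * w x y)) ⟩
    ∑[ x < n ] ∑[ y < n ] ∑L L (λ S → 𝟙 (separates S x y) * w x y)
      ≈⟨ sum-cong-≋ (λ x → sum-cong-≋ (weighted-count x)) ⟩
    ∑[ x < n ] ∑[ y < n ] (s * w x y)
      ≈⟨ sum-cong-≋ (λ x → sym (*-distribˡ-sum s (w x))) ⟩
    ∑[ x < n ] (s * ∑[ y < n ] w x y)
      ≈⟨ sym (*-distribˡ-sum s (λ x → ∑[ y < n ] w x y)) ⟩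
    s * ∑[ x < n ] ∑[ y < n ] w x y ∎
    where
    separated-weight : ∀ x y → ∑L L (λ S → 𝟙 (separates S x y)) * w x y ≈ s * w x y
    separated-weight x y with x ≟ y
    ... | yes ≡.refl = trans (*-congˡ (w-diag x)) (trans (zeroʳ _) (sym (trans (*-congˡ (w-diag x)) (zeroʳ s))))
    ... | no x≢y     = *-congʳ (count x y x≢y)
    weighted-count : ∀ x y → ∑L L (λ S → 𝟙 (separates S x y) * w x y) ≈ s * w x y
    weighted-count x y = trans (∑L-*ʳ L (λ S → 𝟙 (separates S x y)) (w x y)) (separated-weight x y)

module OrderedFieldProperties {c ℓ₁ ℓ₂} (F : OrderedField c ℓ₁ ℓ₂) where
  open OrderedField F hiding (zero) renaming (_≤_ to infix 4 _≤_)
  open import Algebra.Properties.Ring ring using (-1*x≈-x; -‿involutive; [y-z]x≈yx-zx)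
  open import Algebra.Properties.Semiring.Mult semiring using (_×_; ×1-homo-*)
  open import Algebra.Properties.CommutativeSemigroup *-commutativeSemigroup using (xy∙z≈xz∙y)
  open import Relation.Binary.Structures using (IsTotalOrder)
  open import Relation.Binary.Bundles using (Poset)
  open IsTotalOrder isTotalOrder using (isPartialOrder; total; antisym; ≤-respˡ-≈; ≤-respʳ-≈)
    renaming (refl to ≤-refl; reflexive to ≤-reflexive; trans to ≤-trans)

  poset : Poset c ℓ₁ ℓ₂
  poset = record { isPartialOrder = isPartialOrder }

  open import Relation.Binary.Reasoning.PartialOrder poset
  open import Algebra.Properties.Semiring.Sum semiring using (sum; sum-remove)
  open import Data.Vec.Functional using (removeAt)
  open import Data.Fin using (punchIn)
  open SubsetCounting semiring using (∑L)

  +-monoʳ-≤ : ∀ {x y} z → x ≤ y → z + x ≤ z + y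
  +-monoʳ-≤ {x} {y} z x≤y = ≤-respˡ-≈ (+-comm x z) (≤-respʳ-≈ (+-comm y z) (+-mono-≤ z x≤y))

  +-mono₂-≤ : ∀ {x y u v} → x ≤ y → u ≤ v → x + u ≤ y + v
  +-mono₂-≤ {y = y} {u} x≤y u≤v = ≤-trans (+-mono-≤ u x≤y) (+-monoʳ-≤ y u≤v)

  x≤x+y : ∀ {x y} → 0# ≤ y → x ≤ x + y
  x≤x+y {x} 0≤y = ≤-respˡ-≈ (+-identityʳ x) (+-monoʳ-≤ x 0≤y)

  x≤y⇒0≤y-x : ∀ {x y} → x ≤ y → 0# ≤ y - x
  x≤y⇒0≤y-x {x} x≤y = ≤-respˡ-≈ (-‿inverseʳ x) (+-mono-≤ (- x) x≤y)

  0≤y-x⇒x≤y : ∀ {x y} → 0# ≤ y - x → x ≤ y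
  0≤y-x⇒x≤y {x} {y} 0≤y-x = begin
    x             ≈⟨ +-identityˡ x ⟨
    0# + x        ≤⟨ +-mono-≤ x 0≤y-x ⟩
    (y - x) + x   ≈⟨ +-assoc y (- x) x ⟩
    y + (- x + x) ≈⟨ +-congˡ (-‿inverseˡ x) ⟩
    y + 0#        ≈⟨ +-identityʳ y ⟩
    y             ∎

  0≤1 : 0# ≤ 1#
  0≤1 with total 0# 1#
  ... | inj₁ 0≤1 = 0≤1
  ... | inj₂ 1≤0 = ≤-respʳ-≈ -1*-1≈1 (*-nonneg 0≤-1 0≤-1)
    where
    0≤-1 : 0# ≤ - 1#
    0≤-1 = ≤-respʳ-≈ (+-identityˡ (- 1#)) (x≤y⇒0≤y-x 1≤0)
    -1*-1≈1 : - 1# * - 1# ≈ 1#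
    -1*-1≈1 = trans (-1*x≈-x (- 1#)) (-‿involutive 1#)

  *-monoˡ-≤-nonNeg : ∀ {x y z} → 0# ≤ z → x ≤ y → x * z ≤ y * z
  *-monoˡ-≤-nonNeg {x} {y} {z} 0≤z x≤y =
    0≤y-x⇒x≤y (≤-respʳ-≈ ([y-z]x≈yx-zx z y x) (*-nonneg (x≤y⇒0≤y-x x≤y) 0≤z))

  *-cancelʳ-≈ : ∀ {x y z} → ¬ (z ≈ 0#) → x * z ≈ y * z → x ≈ y
  *-cancelʳ-≈ {x} {y} {z} z≉0 xz≈yz = begin-equality
    x                ≈⟨ *-identityʳ x ⟨
    x * 1#           ≈⟨ *-congˡ (⁻¹-inverse z z≉0) ⟨
    x * (z * z ⁻¹)   ≈⟨ *-assoc x z (z ⁻¹) ⟨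
    (x * z) * z ⁻¹   ≈⟨ *-congʳ xz≈yz ⟩
    (y * z) * z ⁻¹   ≈⟨ *-assoc y z (z ⁻¹) ⟩
    y * (z * z ⁻¹)   ≈⟨ *-congˡ (⁻¹-inverse z z≉0) ⟩
    y * 1#           ≈⟨ *-identityʳ y ⟩
    y                ∎

  *-cancelʳ-≤-pos : ∀ {x y z} → 0# ≤ z → ¬ (z ≈ 0#) → x * z ≤ y * z → x ≤ y
  *-cancelʳ-≤-pos {x} {y} 0≤z z≉0 xz≤yz with total x y
  ... | inj₁ x≤y = x≤y
  ... | inj₂ y≤x = ≤-reflexive (*-cancelʳ-≈ z≉0 (antisym xz≤yz (*-monoˡ-≤-nonNeg 0≤z y≤x)))

  fromℕ≡×1# : ∀ n → fromℕ n ≡ n × 1#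
  fromℕ≡×1# zero    = ≡.refl
  fromℕ≡×1# (suc n) = ≡.cong (1# +_) (fromℕ≡×1# n)

  fromℕ-* : ∀ m n → fromℕ (m ℕ.* n) ≈ fromℕ m * fromℕ n
  fromℕ-* m n = begin-equality
    fromℕ (m ℕ.* n)        ≡⟨ fromℕ≡×1# (m ℕ.* n) ⟩
    (m ℕ.* n) × 1#         ≈⟨ ×1-homo-* m n ⟩
    m × 1# * n × 1#        ≡⟨ ≡.cong₂ _*_ (fromℕ≡×1# m) (fromℕ≡×1# n) ⟨
    fromℕ m * fromℕ n      ∎

  fromℕ-2* : ∀ n → fromℕ (2 ℕ.* n) ≈ (1# + 1#) * fromℕ n
  fromℕ-2* n = trans (fromℕ-* 2 n) (*-congʳ (+-congˡ (+-identityʳ 1#)))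

  fromℕ-nonNeg : ∀ n → 0# ≤ fromℕ n
  fromℕ-nonNeg zero    = ≤-refl
  fromℕ-nonNeg (suc n) = ≤-trans 0≤1 (x≤x+y (fromℕ-nonNeg n))

  fromℕ-≉0 : ∀ n .{{_ : NonZero n}} → ¬ (fromℕ n ≈ 0#)
  fromℕ-≉0 (suc n) 1+n≈0 = 0≉1 (antisym 0≤1 (≤-respʳ-≈ 1+n≈0 (x≤x+y (fromℕ-nonNeg n))))

  ≤-by-cross-multiplication : ∀ {a c D w h} → 0# ≤ c → ¬ (c ≈ 0#) → ¬ (D ≈ 0#) →
            a * c ≈ D * w → w ≤ c * h → a * D ⁻¹ ≤ h
  ≤-by-cross-multiplication {a} {c} {D} {w} {h} 0≤c c≉0 D≉0 ac≈Dw w≤ch = *-cancelʳ-≤-pos 0≤c c≉0 (begin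
    a * D ⁻¹ * c     ≈⟨ xy∙z≈xz∙y a (D ⁻¹) c ⟩
    a * c * D ⁻¹     ≈⟨ *-congʳ ac≈Dw ⟩
    D * w * D ⁻¹     ≈⟨ xy∙z≈xz∙y D w (D ⁻¹) ⟩
    D * D ⁻¹ * w     ≈⟨ *-congʳ (⁻¹-inverse D D≉0) ⟩
    1# * w           ≈⟨ *-identityˡ w ⟩
    w                ≤⟨ w≤ch ⟩
    c * h            ≈⟨ *-comm c h ⟩
    h * c            ∎)

  sum-nonNeg : ∀ {n} (f : Fin n → Carrier) → (∀ i → 0# ≤ f i) → 0# ≤ sum f
  sum-nonNeg {zero}  f 0≤f = ≤-refl
  sum-nonNeg {suc n} f 0≤f = ≤-respˡ-≈ (+-identityˡ 0#) (+-mono₂-≤ (0≤f zero) (sum-nonNeg (f ∘ suc) (0≤f ∘ suc)))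

  sum-≉0 : ∀ {n} (f : Fin n → Carrier) → (∀ i → 0# ≤ f i) → ∀ i → ¬ (f i ≈ 0#) → ¬ (sum f ≈ 0#)
  sum-≉0 {suc n} f 0≤f i fi≉0 sum≈0 = fi≉0 (antisym fi≤0 (0≤f i))
    where
    fi≤0 : f i ≤ 0#
    fi≤0 = begin
      f i                          ≤⟨ x≤x+y (sum-nonNeg (removeAt f i) (0≤f ∘ punchIn i)) ⟩
      f i + sum (removeAt f i)     ≈⟨ sum-remove f ⟨
      sum f                        ≈⟨ sum≈0 ⟩
      0#                           ∎

  ∑L-mono-≤ : ∀ {a p} {A : Set a} {P : A → Set p} {L : List A} {f g : A → Carrier} →
              (∀ {S} → P S → f S ≤ g S) → All P L → ∑L L f ≤ ∑L L g
  ∑L-mono-≤ f≤g All.[]         = ≤-refl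
  ∑L-mono-≤ f≤g (pS All.∷ pL) = +-mono₂-≤ (f≤g pS) (∑L-mono-≤ f≤g pL)

  x*y⁻¹≤z⇒x≤z*y : ∀ {x y z} → 0# ≤ y → ¬ (y ≈ 0#) → x * y ⁻¹ ≤ z → x ≤ z * y
  x*y⁻¹≤z⇒x≤z*y {x} {y} {z} 0≤y y≉0 x/y≤z = begin
    x                  ≈⟨ *-identityʳ x ⟨
    x * 1#             ≈⟨ *-congˡ (⁻¹-inverse y y≉0) ⟨
    x * (y * y ⁻¹)     ≈⟨ *-congˡ (*-comm y (y ⁻¹)) ⟩
    x * (y ⁻¹ * y)     ≈⟨ *-assoc x (y ⁻¹) y ⟨
    x * y ⁻¹ * y       ≤⟨ *-monoˡ-≤-nonNeg 0≤y x/y≤z ⟩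
    z * y              ∎

module DualCheegerBounds {c ℓ₁ ℓ₂} (F : RealClosedField c ℓ₁ ℓ₂) where
  open RealClosedField F hiding (zero) renaming (_≤_ to infix 4 _≤_)
  open GraphDefs F
  open OrderedFieldProperties orderedField
  open SubsetCounting semiring
  open import Algebra.Properties.Semiring.Sum semiring
    using (sum; sum-syntax; sum-cong-≋; sum-cong-≗; ∑-distrib-+; *-distribˡ-sum)
  open import Algebra.Properties.Semiring.Mult semiring using (_×_)
  open import Data.Fin.Subset.Properties using (x∈p⇒x∉∁p)
  open import Data.Vec.Properties using (lookup-map)
  open import Data.Nat.Properties using (m≤m+n; m≤n⇒m≤1+n)
  open import Relation.Binary.Structures using (IsTotalOrder)
  open IsTotalOrder isTotalOrder using (≤-respʳ-≈)
  open import Relation.Binary.Reasoning.PartialOrder poset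

  sumF≡sum : ∀ {n} (f : Fin n → Carrier) → sumF f ≡ sum f
  sumF≡sum {zero}  f = ≡.refl
  sumF≡sum {suc n} f = ≡.cong (f zero +_) (sumF≡sum (f ∘ suc))

  module _ {N : ℕ} (b : Fin N → Fin N → Carrier) (isGraph : IsGraph b) where
    private
      b-diag : ∀ x → b x x ≈ 0#
      b-diag = proj₁ (proj₂ isGraph)
      b-nonNeg : ∀ x y → 0# ≤ b x y
      b-nonNeg = proj₂ (proj₂ isGraph)

    totalWeight : Carrier
    totalWeight = ∑[ x < N ] ∑[ y < N ] b x y

    volume-∁ : ∀ S → volume b S + volume b (∁ S) ≈ totalWeight
    volume-∁ S = begin-equality
      volume b S + volume b (∁ S)             ≡⟨ ≡.cong₂ _+_ (sumF≡sum part) (sumF≡sum part∁) ⟩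
      sum part + sum part∁                    ≈⟨ ∑-distrib-+ part part∁ ⟨
      ∑[ x < N ] (part x + part∁ x)           ≈⟨ sum-cong-≋ (λ x → split (lookup S x) (deg b x) (lookup-map x not S)) ⟩
      ∑[ x < N ] deg b x                      ≡⟨ sum-cong-≗ (λ x → sumF≡sum (b x)) ⟩
      totalWeight                             ∎
      where
      part part∁ : Fin N → Carrier
      part  x = if lookup S x then deg b x else 0#
      part∁ x = if lookup (∁ S) x then deg b x else 0#
      split : ∀ a d {a∁} → a∁ ≡ not a → (if a then d else 0#) + (if a∁ then d else 0#) ≈ d
      split true  d ≡.refl = +-identityʳ d
      split false d ≡.refl = +-identityˡ d

    edgeWeight-∁ : ∀ S → edgeWeight b S (∁ S) ≈ ∑[ x < N ] ∑[ y < N ] (𝟙 (separates S x y) * b x y)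
    edgeWeight-∁ S = begin-equality
      edgeWeight b S (∁ S)                                ≡⟨ sumF≡sum row ⟩
      ∑[ x < N ] row x                                    ≈⟨ sum-cong-≋ row-expansion ⟩
      ∑[ x < N ] ∑[ y < N ] (𝟙 (separates S x y) * b x y) ∎
      where
      entry : Fin N → Fin N → Carrier
      entry x y = if lookup (∁ S) y then b x y else 0#
      row : Fin N → Carrier
      row x = if lookup S x then sumF (entry x) else 0#
      entry-expansion : ∀ x y → 𝟙 (lookup S x) * entry x y ≈ 𝟙 (separates S x y) * b x y
      entry-expansion x y = begin-equality
        𝟙 (lookup S x) * entry x y
          ≈⟨ *-congˡ (if-then-0≈𝟙* (lookup (∁ S) y) (b x y)) ⟩
        𝟙 (lookup S x) * (𝟙 (lookup (∁ S) y) * b x y)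
          ≡⟨ ≡.cong (λ a → 𝟙 (lookup S x) * (𝟙 a * b x y)) (lookup-map y not S) ⟩
        𝟙 (lookup S x) * (𝟙 (not (lookup S y)) * b x y)
          ≈⟨ *-assoc _ _ _ ⟨
        𝟙 (lookup S x) * 𝟙 (not (lookup S y)) * b x y
          ≈⟨ *-congʳ (𝟙-∧ (lookup S x) (not (lookup S y))) ⟨
        𝟙 (separates S x y) * b x y ∎
      row-expansion : ∀ x → row x ≈ ∑[ y < N ] (𝟙 (separates S x y) * b x y)
      row-expansion x = begin-equality
        row x                                           ≈⟨ if-then-0≈𝟙* (lookup S x) (sumF (entry x)) ⟩
        𝟙 (lookup S x) * sumF (entry x)                 ≡⟨ ≡.cong (𝟙 (lookup S x) *_) (sumF≡sum (entry x)) ⟩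
        𝟙 (lookup S x) * sum (entry x)                  ≈⟨ *-distribˡ-sum (𝟙 (lookup S x)) (entry x) ⟩
        ∑[ y < N ] (𝟙 (lookup S x) * entry x y)         ≈⟨ sum-cong-≋ (entry-expansion x) ⟩
        ∑[ y < N ] (𝟙 (separates S x y) * b x y)        ∎

    totalWeight-nonNeg : 0# ≤ totalWeight
    totalWeight-nonNeg = sum-nonNeg (λ x → sum (b x)) (λ x → sum-nonNeg (b x) (b-nonNeg x))

    totalWeight-≉0 : HasEdge b → ¬ (totalWeight ≈ 0#)
    totalWeight-≉0 (x , y , bxy≉0) =
      sum-≉0 (λ x → sum (b x)) (λ x → sum-nonNeg (b x) (b-nonNeg x)) x (sum-≉0 (b x) (b-nonNeg x) y bxy≉0)

    averaging : HasEdge b → ∀ h → (∀ V₁ V₂ → Admissible b V₁ V₂ → ratio b V₁ V₂ ≤ h) →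
                ∀ (L : List (Subset N)) → All (λ S → Admissible b S (∁ S)) L →
                ∀ s → (∀ x y → x ≢ y → ∑L L (λ S → 𝟙 (separates S x y)) ≈ s) →
                (1# + 1#) * s ≤ fromℕ (length L) * h
    averaging hasEdge h ratio≤h L admissible s separation = *-cancelʳ-≤-pos totalWeight-nonNeg T≉0 (begin
      (1# + 1#) * s * T                                ≈⟨ *-assoc _ _ _ ⟩
      (1# + 1#) * (s * T)                              ≈⟨ *-congˡ (∑L-cut L s b b-diag separation) ⟨
      (1# + 1#) * ∑L L (λ S → ∑[ x < N ] ∑[ y < N ] (𝟙 (separates S x y) * b x y))
                                                       ≈⟨ *-congˡ (∑L-cong L edgeWeight-∁) ⟨
      (1# + 1#) * ∑L L (λ S → edgeWeight b S (∁ S))   ≈⟨ ∑L-*ˡ L (1# + 1#) _ ⟨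
      ∑L L (λ S → (1# + 1#) * edgeWeight b S (∁ S))   ≤⟨ ∑L-mono-≤ cut≤ admissible ⟩
      ∑L L (λ _ → h * T)                               ≈⟨ ∑L-const L (h * T) ⟩
      (length L × 1#) * (h * T)                        ≡⟨ ≡.cong (_* (h * T)) (fromℕ≡×1# (length L)) ⟨
      fromℕ (length L) * (h * T)                       ≈⟨ *-assoc _ _ _ ⟨
      fromℕ (length L) * h * T                         ∎)
      where
      T : Carrier
      T = totalWeight
      T≉0 : ¬ (T ≈ 0#)
      T≉0 = totalWeight-≉0 hasEdge
      cut≤ : ∀ {S} → Admissible b S (∁ S) → (1# + 1#) * edgeWeight b S (∁ S) ≤ h * T
      cut≤ {S} adm = ≤-respʳ-≈ (*-congˡ V≈T) (x*y⁻¹≤z⇒x≤z*y 0≤V V≉0 (ratio≤h S (∁ S) adm))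
        where
        V≈T : volume b S + volume b (∁ S) ≈ T
        V≈T = volume-∁ S
        0≤V : 0# ≤ volume b S + volume b (∁ S)
        0≤V = ≤-respʳ-≈ (sym V≈T) totalWeight-nonNeg
        V≉0 : ¬ (volume b S + volume b (∁ S) ≈ 0#)
        V≉0 = T≉0 ∘ trans (sym V≈T)

  module _ {n : ℕ} (b : Fin (2 ℕ.+ n) → Fin (2 ℕ.+ n) → Carrier) (isGraph : IsGraph b) (hasEdge : HasEdge b)
           (h : Carrier) (ratio≤h : ∀ V₁ V₂ → Admissible b V₁ V₂ → ratio b V₁ V₂ ≤ h) where

    averaging-subsetsOfSize : ∀ {k} → k ℕ.≤ n → fromℕ (2 ℕ.* (n C k)) ≤ fromℕ ((2 ℕ.+ n) C suc k) * h
    averaging-subsetsOfSize {k} k≤n = begin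
      fromℕ (2 ℕ.* (n C k))                          ≈⟨ fromℕ-2* (n C k) ⟩
      (1# + 1#) * fromℕ (n C k)                      ≤⟨ averaging b isGraph hasEdge h ratio≤h L admissible _ separation ⟩
      fromℕ (length L) * h
        ≡⟨ ≡.cong (λ m → fromℕ m * h) (length-subsetsOfSize (2 ℕ.+ n) (suc k)) ⟩
      fromℕ ((2 ℕ.+ n) C suc k) * h                  ∎
      where
      L : List (Subset (2 ℕ.+ n))
      L = subsetsOfSize (2 ℕ.+ n) (suc k)
      admissible : All (λ S → Admissible b S (∁ S)) L
      admissible = All.zipWith (λ (S≠∅ , ∁S≠∅) → S≠∅ , ∁S≠∅ , λ _ → x∈p⇒x∉∁p)
        (subsetsOfSize-nonempty (2 ℕ.+ n) k , subsetsOfSize-∁-nonempty (s≤s k≤n))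
      separation : ∀ x y → x ≢ y → ∑L L (λ S → 𝟙 (separates S x y)) ≈ fromℕ (n C k)
      separation x y x≢y = trans (count-separates n k x y x≢y) (reflexive (≡.sym (fromℕ≡×1# (n C k))))

    dualCheeger-≥ : ∀ {k} a D .{{_ : NonZero D}} → k ℕ.≤ n →
                    a ℕ.* ((2 ℕ.+ n) C suc k) ≡ D ℕ.* (2 ℕ.* (n C k)) → fromℕ a * fromℕ D ⁻¹ ≤ h
    dualCheeger-≥ {k} a D k≤n identity =
      ≤-by-cross-multiplication (fromℕ-nonNeg #L) (fromℕ-≉0 #L {{#L≢0}}) (fromℕ-≉0 D) cross-multiplied
        (averaging-subsetsOfSize k≤n)
      where
      #L : ℕ
      #L = (2 ℕ.+ n) C suc k
      #L≢0 : NonZero #L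
      #L≢0 = ℕ.>-nonZero (nCk>0 (s≤s (m≤n⇒m≤1+n k≤n)))
      cross-multiplied : fromℕ a * fromℕ #L ≈ fromℕ D * fromℕ (2 ℕ.* (n C k))
      cross-multiplied = begin-equality
        fromℕ a * fromℕ #L                    ≈⟨ fromℕ-* a #L ⟨
        fromℕ (a ℕ.* #L)                      ≡⟨ ≡.cong fromℕ identity ⟩
        fromℕ (D ℕ.* (2 ℕ.* (n C k)))         ≈⟨ fromℕ-* D (2 ℕ.* (n C k)) ⟩
        fromℕ D * fromℕ (2 ℕ.* (n C k))       ∎

    dualCheeger-≥-even : ∀ k → 2 ℕ.+ n ≡ 2 ℕ.* suc k → fromℕ (2 ℕ.+ n) * fromℕ (2 ℕ.* suc n) ⁻¹ ≤ h
    dualCheeger-≥-even k N≡2K = dualCheeger-≥ (2 ℕ.+ n) (2 ℕ.* suc n)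
      (≡.subst (k ℕ.≤_) (≡.sym n≡k+k) (m≤m+n k k)) (C-even-identity k n≡k+k)
      where
      n≡k+k : n ≡ k ℕ.+ k
      n≡k+k = even-half N≡2K

    dualCheeger-≥-odd : ∀ k → 2 ℕ.+ n ≡ 2 ℕ.* suc k ℕ.+ 1 →
                        fromℕ (2 ℕ.+ n ℕ.+ 1) * fromℕ (2 ℕ.* (2 ℕ.+ n)) ⁻¹ ≤ h
    dualCheeger-≥-odd k N≡2K+1 = dualCheeger-≥ (2 ℕ.+ n ℕ.+ 1) (2 ℕ.* (2 ℕ.+ n))
      (≡.subst (k ℕ.≤_) (≡.sym n≡1+k+k) (m≤n⇒m≤1+n (m≤m+n k k))) (C-odd-identity k n≡1+k+k)
      where
      n≡1+k+k : n ≡ suc (k ℕ.+ k)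
      n≡1+k+k = odd-half N≡2K+1

open import Level using (Level)
open import Data.Nat using (ℕ; _+_; _*_; _∸_; _≤_)
open import Data.Fin using (Fin)
open import Data.Product using (_×_)
open import Relation.Binary.PropositionalEquality using (_≡_)


mainTheorem2 : ∀ {c ℓ₁ ℓ₂ : Level} (F : RealClosedField c ℓ₁ ℓ₂) (N : ℕ)
    (b : Fin N → Fin N → RealClosedField.Carrier F) →
    GraphDefs.IsGraph F b → GraphDefs.NoIsolated F b → GraphDefs.HasEdge F b →
    (h : RealClosedField.Carrier F) → GraphDefs.IsDualCheeger F b h →
    (∀ (K : ℕ) → N ≡ 2 * K → 2 ≤ N →
      RealClosedField._≤_ F
        (RealClosedField._*_ F (RealClosedField.fromℕ F N)
          (RealClosedField._⁻¹ F (RealClosedField.fromℕ F (2 * (N ∸ 1)))))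
        h)
    ×
    (∀ (K : ℕ) → N ≡ 2 * K + 1 → 2 Data.Nat.< N →
      RealClosedField._≤_ F
        (RealClosedField._*_ F (RealClosedField.fromℕ F (N + 1))
          (RealClosedField._⁻¹ F (RealClosedField.fromℕ F (2 * N))))
        h)
mainTheorem2 F zero          _ _ _ _ _ _ = (λ { _ _ () }) , (λ { _ _ () })
mainTheorem2 F (suc zero)    _ _ _ _ _ _ = (λ { _ _ (s≤s ()) }) , (λ { _ _ (s≤s ()) })
-- Isolated vertices do no harm: the argument only needs b(V) > 0, which the edge provides.
mainTheorem2 F (suc (suc n)) b isGraph _ hasEdge h (_ , ratio≤h) =
  (λ { zero () _ ; (suc k) N≡2K _ → dualCheeger-≥-even b isGraph hasEdge h ratio≤h k N≡2K }) ,
  (λ { zero () _ ; (suc k) N≡2K+1 _ → dualCheeger-≥-odd b isGraph hasEdge h ratio≤h k N≡2K+1 })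
  where
  open DualCheegerBounds F using (dualCheeger-≥-even; dualCheeger-≥-odd)
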